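{- Let $(H,\eta)$ be an extended strip decomposition of a graph $G$ and let $x,y\in V(G)$ be two distinct vertices that are peripheral in $(H,\eta)$. Let $Q=(x=x_0,x_1,\dots,x_k=y)$ be an induced path in $G$ with endpoints $x$ and $y$. Then for every edge $e=ab\in E(H)$ with $V(Q)\cap\eta(e)\ne\emptyset$, the graph $G[V(Q)\cap\eta(e)]$ is a path with one endpoint in $\eta(e,a)$, the other endpoint in $\eta(e,b)$, and all internal vertices in $\eta(e)\setminus(\eta(e,a)\cup\eta(e,b))$.
   Context: All graphs are finite and simple. $T(H)$ denotes the set of triangles of $H$. An extended strip decomposition of $G$ is a pair $(H,\eta)$ where $H$ is a simple graph, $\eta(x)\subseteq V(G)$ for each $x\in V(H)$, $\eta(xy)\subseteq V(G)$ for each $xy\in E(H)$ together with subsets $\eta(xy,x),\eta(xy,y)\subseteq\eta(xy)$ (interfaces), and $\eta(xyz)\subseteq V(G)$ for each $xyz\in T(H)$, such that: (1) the sets $\eta(o)$, $o\in V(H)\cup E(H)\cup T(H)$, partition $V(G)$; (2) for every $x\in V(H)$ and distinct $y,z\in N_H(x)$, $\eta(xy,x)$ is complete to $\eta(xz,x)$; (3) every edge $uv\in E(G)$ either has both ends in one set $\eta(o)$, or $u\in\eta(xy,x)$, $v\in\eta(xz,x)$ for some $x\in V(H)$ and $y,z\in N_H(x)$, or $u\in\eta(xy,x)$, $v\in\eta(x)$ for some $xy\in E(H)$, or $u\in\eta(xyz)$ and $v\in\eta(xy,x)\cap\eta(xy,y)$ for some $xyz\in T(H)$. A vertex $v\in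 V(G)$ is peripheral in $(H,\eta)$ if there is a vertex $x$ of degree one in $H$ with unique neighbor $y$ such that $\eta(xy,x)=\{v\}$. A path may consist of a single vertex, in which case its two endpoints coincide. -}

module Defs where

open import Data.Nat using (ℕ; suc)
open import Data.Fin using (Fin; toℕ; fromℕ; zero) renaming (_<_ to _<ᶠ_)
open import Data.Fin.Subset using (Subset; _∈_; _∉_; _⊆_; ⁅_⁆)
open import Data.Bool using (Bool; true; false)
open import Data.Product using (Σ; ∃; ∃-syntax; _×_; _,_)
open import Data.Sum using (_⊎_)
open import Data.Unit using (⊤)
open import Relation.Binary.PropositionalEquality using (_≡_; _≢_)
open import Function.Definitions using (Injective)

record Graph (n : ℕ) : Set where
  field
    adj    : Fin n → Fin n → Bool
    sym    : ∀ u v → adj u v ≡ adj v u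
    irrefl : ∀ u → adj u u ≡ false

  Adj : Fin n → Fin n → Set
  Adj u v = adj u v ≡ true

  Tri : Fin n → Fin n → Fin n → Set
  Tri x y z = Adj x y × Adj y z × Adj x z

open Graph public

-- Induced paths: p : Fin (suc m) → Fin n enumerates the path
-- p 0, p 1, …, p m (distinct vertices); consecutive vertices are
-- adjacent and non-consecutive ones are not.  m = 0 is a one-vertex path.

Consecutive : ∀ {k} → Fin k → Fin k → Set
Consecutive i j = toℕ i ≡ suc (toℕ j) ⊎ toℕ j ≡ suc (toℕ i)

IsInducedPath : ∀ {n} (G : Graph n) {m : ℕ} → (Fin (suc m) → Fin n) → Set
IsInducedPath G p =
  Injective _≡_ _≡_ p ×
  (∀ i j → (Adj G (p i) (p j) → Consecutive i j) × (Consecutive i j → Adj G (p i) (p j)))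

-- Objects of H: vertices, edges, triangles.  Canonical representatives
-- (increasing order) are used for the partition condition.

data Obj (h : ℕ) : Set where
  vtx : Fin h → Obj h
  edg : Fin h → Fin h → Obj h
  tri : Fin h → Fin h → Fin h → Obj h

ValidObj : ∀ {h} → Graph h → Obj h → Set
ValidObj H (vtx x)     = ⊤
ValidObj H (edg x y)   = x <ᶠ y × Adj H x y
ValidObj H (tri x y z) = x <ᶠ y × y <ᶠ z × Tri H x y z

-- Extended strip decomposition (H , η) of G.
--   ηV x        = η(x)
--   ηE x y      = η(xy)          (symmetric in x y on edges)
--   ηI x y      = η(xy , x)      (interface of the edge xy at x)
--   ηT x y z    = η(xyz)         (invariant under permutations on triangles)

ηObj : ∀ {n h} → (Fin h → Subset n) → (Fin h → Fin h → Subset n) →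
       (Fin h → Fin h → Fin h → Subset n) → Obj h → Subset n
ηObj ηV ηE ηT (vtx x)     = ηV x
ηObj ηV ηE ηT (edg x y)   = ηE x y
ηObj ηV ηE ηT (tri x y z) = ηT x y z

AllowedEdge : ∀ {n h} (H : Graph h) →
  (ηV : Fin h → Subset n) → (ηE ηI : Fin h → Fin h → Subset n) →
  (ηT : Fin h → Fin h → Fin h → Subset n) → Fin n → Fin n → Set
AllowedEdge H ηV ηE ηI ηT u v =
  (∃[ o ] (ValidObj H o × u ∈ ηObj ηV ηE ηT o × v ∈ ηObj ηV ηE ηT o)) ⊎
  (∃[ x ] ∃[ y ] ∃[ z ] (Adj H x y × Adj H x z × u ∈ ηI x y × v ∈ ηI x z)) ⊎
  (∃[ x ] ∃[ y ] (Adj H x y × u ∈ ηI x y × v ∈ ηV x)) ⊎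
  (∃[ x ] ∃[ y ] ∃[ z ] (Tri H x y z × u ∈ ηT x y z × v ∈ ηI x y × v ∈ ηI y x))

record ESD {n h : ℕ} (G : Graph n) (H : Graph h) : Set where
  field
    ηV : Fin h → Subset n
    ηE : Fin h → Fin h → Subset n
    ηI : Fin h → Fin h → Subset n
    ηT : Fin h → Fin h → Fin h → Subset n

  ηO : Obj h → Subset n
  ηO = ηObj ηV ηE ηT

  field
    ηE-sym   : ∀ x y → Adj H x y → ηE x y ≡ ηE y x
    ηT-sym₁  : ∀ x y z → Tri H x y z → ηT x y z ≡ ηT y x z
    ηT-sym₂  : ∀ x y z → Tri H x y z → ηT x y z ≡ ηT x z y
    ηI⊆ηE    : ∀ x y → Adj H x y → ηI x y ⊆ ηE x y
    covers   : ∀ v → ∃[ o ] (ValidObj H o × v ∈ ηO o)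
    disjoint : ∀ v o o' → ValidObj H o → ValidObj H o' →
               v ∈ ηO o → v ∈ ηO o' → o ≡ o'
    complete : ∀ x y z → Adj H x y → Adj H x z → y ≢ z →
               ∀ u v → u ∈ ηI x y → v ∈ ηI x z → Adj G u v
    edges    : ∀ u v → Adj G u v →
               AllowedEdge H ηV ηE ηI ηT u v ⊎ AllowedEdge H ηV ηE ηI ηT v u

open ESD public

Peripheral : ∀ {n h} {G : Graph n} {H : Graph h} → ESD G H → Fin n → Set
Peripheral {H = H} D v =
  ∃[ x ] ∃[ y ] (Adj H x y × (∀ z → Adj H x z → z ≡ y) × ηI D x y ≡ ⁅ v ⁆)

-- The path is enumerated as p 0, …, p m; a single vertex (m = 0) is allowed.

open import Data.Nat using (_<_)

InducedPathOn : ∀ {n} (G : Graph n) (S : Fin n → Set) (A B : Subset n) → Set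
InducedPathOn {n} G S A B =
  ∃[ m ] ∃[ p ] (IsInducedPath G {m} p ×
    (∀ i → S (p i)) ×
    (∀ v → S v → ∃[ i ] p i ≡ v) ×
    p zero ∈ A ×
    p (fromℕ m) ∈ B ×
    (∀ i → 0 < toℕ i → toℕ i < m → p i ∉ A × p i ∉ B))

-- Say that Q visits the hub of a vertex c of H at index i if q i lies in some interface η(cf, c).
-- The key fact is that two visits of one hub are never two or more steps apart. By completeness of
-- the interfaces at c, such visits i < j lie in a common interface η(cf, c). Walk along Q from i to
-- the left and from j to the right until leaving the zone of cf, the union of the bags of cf, c, f
-- and of the triangles on cf. An exit through another interface at c would be complete to η(cf, c),
-- hence adjacent to q j or q i. Reaching an end of Q instead makes c or f a leaf of H with interface
-- {x} or {y}; not c, as η(cf, c) contains q i and q j, and a leaf f is incompatible with what happens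
-- on the other side. So both walks exit through interfaces at f, giving two visits of the hub of f
-- that are further apart still, and this descent cannot go on forever. It follows that Q avoids
-- every vertex bag, and that for the first and last indices s and t of Q in η(ab), the vertices q s
-- and q t lie in opposite interfaces η(ab, a) and η(ab, b), while all indices strictly between them
-- lie in η(ab) but in neither interface.
module Submission where

open import Defs hiding (sym)
open import Data.Nat as ℕ using (ℕ; zero; suc; _+_; _∸_; ∣_-_∣; z≤n; s≤s)
import Data.Nat.Properties as ℕ
open import Data.Fin using (Fin; zero; suc; fromℕ; toℕ; fromℕ<; opposite; _<_; _≤_)
open import Data.Fin.Properties
  using (<-cmp; _≟_; any?; toℕ-injective; toℕ-fromℕ; toℕ-fromℕ<; toℕ<n; opposite-prop; opposite-involutive)
open import Data.Fin.Induction using (<-wellFounded; Acc; acc)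
open import Data.Fin.Subset using (Subset; _∈_; _∉_; ⁅_⁆)
open import Data.Fin.Subset.Properties using (_∈?_; x∈⁅x⁆; x∈⁅y⁆⇒x≡y)
import Data.Bool as Bool
open import Data.Product using (∃-syntax; ∃₂; _×_; _,_; proj₁; proj₂; uncurry)
open import Data.Sum as Sum using (_⊎_; inj₁; inj₂)
open import Data.Empty using (⊥-elim)
open import Function using (_∘_)
open import Level using (0ℓ)
open import Relation.Nullary using (¬_; Dec; yes; no; _⊎-dec_; _×-dec_)
open import Relation.Unary using (Pred; Decidable)
open import Relation.Binary.Definitions using (tri<; tri≈; tri>)
open import Relation.Binary.PropositionalEquality
  using (_≡_; _≢_; refl; sym; trans; cong; subst; module ≡-Reasoning)

Adj-sym : ∀ {n} (Γ : Graph n) {u v} → Adj Γ u v → Adj Γ v u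
Adj-sym Γ {u} {v} uv = trans (Graph.sym Γ v u) uv

Adj⇒≢ : ∀ {n} (Γ : Graph n) {u v} → Adj Γ u v → u ≢ v
Adj⇒≢ Γ {u} uu refl with trans (sym uu) (irrefl Γ u)
... | ()

Step : ∀ {m} → Fin m → Fin m → Set
Step l r = toℕ r ≡ suc (toℕ l)

_≪_ : ∀ {m} → Fin m → Fin m → Set
i ≪ j = suc (toℕ i) ℕ.< toℕ j

Step⇒< : ∀ {m} {l r : Fin m} → Step l r → l < r
Step⇒< l→r = ℕ.≤-reflexive (sym l→r)

≪⇒< : ∀ {m} {i j : Fin m} → i ≪ j → i < j
≪⇒< = ℕ.<-trans (ℕ.n<1+n _)

≪-widen : ∀ {m} {l i j r : Fin m} → l < i → i ≤ j → j < r → l ≪ r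
≪-widen l<i i≤j j<r = ℕ.≤-trans (s≤s (ℕ.≤-trans l<i i≤j)) j<r

StartsAt : ∀ {k} → Pred (Fin (suc k)) 0ℓ → Fin (suc k) → Set
StartsAt P s = s ≡ zero ⊎ ∃[ l ] (Step l s × ¬ P l)

EndsAt : ∀ {k} → Pred (Fin (suc k)) 0ℓ → Fin (suc k) → Set
EndsAt {k} P t = t ≡ fromℕ k ⊎ ∃[ r ] (Step t r × ¬ P r)

lowest : ∀ {k} {P : Pred (Fin (suc k)) 0ℓ} → Decidable P → ∀ {i} → P i →
         ∃[ s ] (s ≤ i × P s × StartsAt P s × (∀ j → j < s → ¬ P j))
lowest P? {zero} Pi = zero , z≤n , Pi , inj₁ refl , λ _ ()
lowest {suc k} {P} P? {suc i} Pi with P? zero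
... | yes P0 = zero , z≤n , P0 , inj₁ refl , λ _ ()
... | no ¬P0 with lowest (P? ∘ suc) Pi
...   | s , s≤i , Ps , start , below = suc s , s≤s s≤i , Ps , shift start , below′
  where
  shift : StartsAt (P ∘ suc) s → StartsAt P (suc s)
  shift (inj₁ refl) = inj₂ (zero , refl , ¬P0)
  shift (inj₂ (l , l→s , ¬Pl)) = inj₂ (suc l , cong suc l→s , ¬Pl)
  below′ : ∀ j → j < suc s → ¬ P j
  below′ zero _ = ¬P0
  below′ (suc j) (s≤s j<s) = below j j<s

highest : ∀ {k} {P : Pred (Fin (suc k)) 0ℓ} → Decidable P → ∀ {i} → P i →
          ∃[ t ] (i ≤ t × P t × EndsAt P t × (∀ j → t < j → ¬ P j))
highest {zero} P? {zero} Pi = zero , z≤n , Pi , inj₁ refl , λ { zero () }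
highest {suc k} {P} P? {suc i} Pi with highest (P? ∘ suc) Pi
... | t , i≤t , Pt , end , above = suc t , s≤s i≤t , Pt , shift end , above′
  where
  shift : EndsAt (P ∘ suc) t → EndsAt P (suc t)
  shift (inj₁ refl) = inj₁ refl
  shift (inj₂ (r , t→r , ¬Pr)) = inj₂ (suc r , cong suc t→r , ¬Pr)
  above′ : ∀ j → suc t < j → ¬ P j
  above′ (suc j) (s≤s t<j) = above j t<j
highest {suc k} {P} P? {zero} Pi with any? (P? ∘ suc)
... | yes (j , Psj) with highest P? {suc j} Psj
...   | t , _ , rest = t , z≤n , rest
highest {suc k} {P} P? {zero} Pi | no ¬∃ =
  zero , z≤n , Pi , inj₂ (suc zero , refl , λ P1 → ¬∃ (zero , P1)) , above
  where
  above : ∀ j → zero {suc k} < j → ¬ P j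
  above (suc j) _ Psj = ¬∃ (j , Psj)

within-extremes : ∀ {k} {P : Pred (Fin (suc k)) 0ℓ} {s t : Fin (suc k)} →
                  (∀ j → j < s → ¬ P j) → (∀ j → t < j → ¬ P j) → ∀ j → P j → s ≤ j × j ≤ t
within-extremes below above j Pj =
  ℕ.≮⇒≥ (λ j<s → below j j<s Pj) , ℕ.≮⇒≥ (λ t<j → above j t<j Pj)

crossing : ∀ {k} {P : Pred (Fin (suc k)) 0ℓ} → Decidable P →
           ∀ {i j} → P i → ¬ P j → i ≤ j → ∃₂ λ l r → Step l r × i ≤ l × r ≤ j × P l × ¬ P r
crossing P? {zero} {zero} Pi ¬Pj _ = ⊥-elim (¬Pj Pi)
crossing {suc k} P? {zero} {suc j} Pi ¬Pj _ with P? (suc zero)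
... | no ¬P1 = zero , suc zero , refl , z≤n , s≤s z≤n , Pi , ¬P1
... | yes P1 with crossing (P? ∘ suc) {zero} {j} P1 ¬Pj z≤n
...   | l , r , l→r , _ , r≤j , Pl , ¬Pr = suc l , suc r , cong suc l→r , z≤n , s≤s r≤j , Pl , ¬Pr
crossing {suc k} P? {suc i} {suc j} Pi ¬Pj (s≤s i≤j) with crossing (P? ∘ suc) Pi ¬Pj i≤j
... | l , r , l→r , i≤l , r≤j , Pl , ¬Pr =
  suc l , suc r , cong suc l→r , s≤s i≤l , s≤s r≤j , Pl , ¬Pr

∣1+n-n∣≡1 : ∀ n → ∣ suc n - n ∣ ≡ 1
∣1+n-n∣≡1 zero = refl
∣1+n-n∣≡1 (suc n) = ∣1+n-n∣≡1 n

∣m-n∣≡1⇒m≡1+n⊎n≡1+m : ∀ m n → ∣ m - n ∣ ≡ 1 → m ≡ suc n ⊎ n ≡ suc m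
∣m-n∣≡1⇒m≡1+n⊎n≡1+m zero (suc zero) _ = inj₂ refl
∣m-n∣≡1⇒m≡1+n⊎n≡1+m (suc zero) zero _ = inj₁ refl
∣m-n∣≡1⇒m≡1+n⊎n≡1+m (suc m) (suc n) e with ∣m-n∣≡1⇒m≡1+n⊎n≡1+m m n e
... | inj₁ m≡1+n = inj₁ (cong suc m≡1+n)
... | inj₂ n≡1+m = inj₂ (cong suc n≡1+m)

consecutive⇒∣-∣≡1 : ∀ {m} {i j : Fin m} → Consecutive i j → ∣ toℕ i - toℕ j ∣ ≡ 1
consecutive⇒∣-∣≡1 {j = j} (inj₁ i≡1+j) rewrite i≡1+j = ∣1+n-n∣≡1 (toℕ j)
consecutive⇒∣-∣≡1 {i = i} (inj₂ j≡1+i) rewrite j≡1+i =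
  trans (ℕ.∣-∣-comm (toℕ i) (suc (toℕ i))) (∣1+n-n∣≡1 (toℕ i))

∣-∣≡1⇒consecutive : ∀ {m} {i j : Fin m} → ∣ toℕ i - toℕ j ∣ ≡ 1 → Consecutive i j
∣-∣≡1⇒consecutive {i = i} {j} = ∣m-n∣≡1⇒m≡1+n⊎n≡1+m (toℕ i) (toℕ j)

∣m∸a-m∸b∣≡∣a-b∣ : ∀ {m a b} → a ℕ.≤ m → b ℕ.≤ m → ∣ m ∸ a - m ∸ b ∣ ≡ ∣ a - b ∣
∣m∸a-m∸b∣≡∣a-b∣ {m} {zero} {zero} _ _ = ℕ.∣n-n∣≡0 m
∣m∸a-m∸b∣≡∣a-b∣ {m} {zero} {suc b} _ b≤m =
  trans (ℕ.m≤n⇒∣n-m∣≡n∸m (ℕ.m∸n≤m m (suc b))) (ℕ.m∸[m∸n]≡n b≤m)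
∣m∸a-m∸b∣≡∣a-b∣ {m} {suc a} {zero} a≤m _ =
  trans (ℕ.m≤n⇒∣m-n∣≡n∸m (ℕ.m∸n≤m m (suc a))) (ℕ.m∸[m∸n]≡n a≤m)
∣m∸a-m∸b∣≡∣a-b∣ {suc m} {suc a} {suc b} (s≤s a≤m) (s≤s b≤m) = ∣m∸a-m∸b∣≡∣a-b∣ a≤m b≤m

module IndexWindow {k} {s t : Fin (suc k)} (s≤t : s ≤ t) where

  len : ℕ
  len = toℕ t ∸ toℕ s

  s+len≡t : toℕ s + len ≡ toℕ t
  s+len≡t = ℕ.m+[n∸m]≡n s≤t

  s+i≤t : ∀ (i : Fin (suc len)) → toℕ s + toℕ i ℕ.≤ toℕ t
  s+i≤t i = ℕ.≤-trans (ℕ.+-monoʳ-≤ (toℕ s) (ℕ.≤-pred (toℕ<n i))) (ℕ.≤-reflexive s+len≡t)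

  φ : Fin (suc len) → Fin (suc k)
  φ i = fromℕ< (ℕ.≤-trans (s≤s (s+i≤t i)) (toℕ<n t))

  toℕ-φ : ∀ i → toℕ (φ i) ≡ toℕ s + toℕ i
  toℕ-φ i = toℕ-fromℕ< _

  isometry : ∀ i j → ∣ toℕ (φ i) - toℕ (φ j) ∣ ≡ ∣ toℕ i - toℕ j ∣
  isometry i j rewrite toℕ-φ i | toℕ-φ j = ℕ.∣m+n-m+o∣≡∣n-o∣ (toℕ s) (toℕ i) (toℕ j)

  s≤φ : ∀ i → s ≤ φ i
  s≤φ i = subst (toℕ s ℕ.≤_) (sym (toℕ-φ i)) (ℕ.m≤m+n (toℕ s) (toℕ i))

  φ≤t : ∀ i → φ i ≤ t
  φ≤t i = subst (ℕ._≤ toℕ t) (sym (toℕ-φ i)) (s+i≤t i)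

  φ-zero : φ zero ≡ s
  φ-zero = toℕ-injective (trans (toℕ-φ zero) (ℕ.+-identityʳ (toℕ s)))

  φ-last : φ (fromℕ len) ≡ t
  φ-last = toℕ-injective (trans (toℕ-φ (fromℕ len)) (trans (cong (toℕ s +_) (toℕ-fromℕ len)) s+len≡t))

  φ-onto : ∀ m → s ≤ m → m ≤ t → ∃[ i ] φ i ≡ m
  φ-onto m s≤m m≤t = fromℕ< m-s<1+len , toℕ-injective
    (trans (toℕ-φ _) (trans (cong (toℕ s +_) (toℕ-fromℕ< m-s<1+len)) (ℕ.m+[n∸m]≡n s≤m)))
    where
    m-s<1+len : toℕ m ∸ toℕ s ℕ.< suc len
    m-s<1+len = s≤s (ℕ.∸-monoˡ-≤ (toℕ s) m≤t)

  φ-interior : ∀ i → 0 ℕ.< toℕ i → toℕ i ℕ.< len → s < φ i × φ i < t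
  φ-interior i 0<i i<len =
    subst (toℕ s ℕ.<_) (sym (toℕ-φ i)) (ℕ.m<m+n (toℕ s) 0<i) ,
    subst (ℕ._< toℕ t) (sym (toℕ-φ i)) (ℕ.≤-trans (ℕ.+-monoʳ-< (toℕ s) i<len) (ℕ.≤-reflexive s+len≡t))

module _ {n} {G : Graph n} where

  isometric-reindex : ∀ {k m} {q : Fin (suc k) → Fin n} → IsInducedPath G q →
                      (φ : Fin (suc m) → Fin (suc k)) →
                      (∀ i j → ∣ toℕ (φ i) - toℕ (φ j) ∣ ≡ ∣ toℕ i - toℕ j ∣) →
                      IsInducedPath G (q ∘ φ)
  isometric-reindex {q = q} (q-injective , q-adjacency) φ isometry = injective , adjacency
    where
    open ≡-Reasoning
    injective : ∀ {i j} → q (φ i) ≡ q (φ j) → i ≡ j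
    injective {i} {j} e = toℕ-injective (ℕ.∣m-n∣≡0⇒m≡n (begin
      ∣ toℕ i - toℕ j ∣          ≡⟨ isometry i j ⟨
      ∣ toℕ (φ i) - toℕ (φ j) ∣  ≡⟨ cong (λ w → ∣ toℕ w - toℕ (φ j) ∣) (q-injective e) ⟩
      ∣ toℕ (φ j) - toℕ (φ j) ∣  ≡⟨ ℕ.∣n-n∣≡0 (toℕ (φ j)) ⟩
      0                          ∎))
    adjacency : ∀ i j → (Adj G (q (φ i)) (q (φ j)) → Consecutive i j) ×
                        (Consecutive i j → Adj G (q (φ i)) (q (φ j)))
    adjacency i j with q-adjacency (φ i) (φ j)
    ... | adj⇒cons , cons⇒adj =
      (λ a → ∣-∣≡1⇒consecutive (trans (sym (isometry i j)) (consecutive⇒∣-∣≡1 (adj⇒cons a)))) ,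
      (λ c → cons⇒adj (∣-∣≡1⇒consecutive (trans (isometry i j) (consecutive⇒∣-∣≡1 c))))

  InducedPathOn-swap : ∀ {S : Fin n → Set} {A B : Subset n} →
                       InducedPathOn G S A B → InducedPathOn G S B A
  InducedPathOn-swap {S} {A} {B} (m , p , p-induced , inS , cover , pA , pB , interior) =
    m , p ∘ opposite , isometric-reindex p-induced opposite isometry , inS ∘ opposite ,
    cover′ , pB , subst (λ i → p i ∈ A) (sym opposite-last) pA , interior′
    where
    toℕ-opposite : ∀ i → toℕ (opposite i) ≡ m ∸ toℕ i
    toℕ-opposite = opposite-prop
    isometry : ∀ i j → ∣ toℕ (opposite i) - toℕ (opposite j) ∣ ≡ ∣ toℕ i - toℕ j ∣
    isometry i j rewrite toℕ-opposite i | toℕ-opposite j =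
      ∣m∸a-m∸b∣≡∣a-b∣ (ℕ.≤-pred (toℕ<n i)) (ℕ.≤-pred (toℕ<n j))
    cover′ : ∀ v → S v → ∃[ i ] p (opposite i) ≡ v
    cover′ v Sv with cover v Sv
    ... | i , pi≡v = opposite i , trans (cong p (opposite-involutive i)) pi≡v
    opposite-last : opposite (fromℕ m) ≡ zero
    opposite-last =
      toℕ-injective (trans (toℕ-opposite (fromℕ m)) (trans (cong (m ∸_) (toℕ-fromℕ m)) (ℕ.n∸n≡0 m)))
    interior′ : ∀ i → 0 ℕ.< toℕ i → toℕ i ℕ.< m → p (opposite i) ∉ B × p (opposite i) ∉ A
    interior′ i 0<i i<m
      with interior (opposite i) (subst (0 ℕ.<_) (sym (toℕ-opposite i)) (ℕ.m<n⇒0<n∸m i<m))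
                                 (subst (ℕ._< m) (sym (toℕ-opposite i)) (ℕ.∸-monoʳ-< 0<i (ℕ.<⇒≤ i<m)))
    ... | ∉A , ∉B = ∉B , ∉A

  segment : ∀ {k} {q : Fin (suc k) → Fin n} → IsInducedPath G q →
            (S : Fin n → Set) (A B : Subset n) {s t : Fin (suc k)} → s ≤ t →
            (∀ m → s ≤ m → m ≤ t → S (q m)) →
            (∀ v → S v → ∃[ m ] (s ≤ m × m ≤ t × q m ≡ v)) →
            q s ∈ A → q t ∈ B →
            (∀ m → s < m → m < t → q m ∉ A × q m ∉ B) →
            InducedPathOn G S A B
  segment {k} {q} q-induced S A B s≤t inS cover qs∈A qt∈B interior =
    len , q ∘ φ , isometric-reindex q-induced φ isometry , (λ i → inS (φ i) (s≤φ i) (φ≤t i)) ,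
    cover′ , subst (λ m → q m ∈ A) (sym φ-zero) qs∈A , subst (λ m → q m ∈ B) (sym φ-last) qt∈B ,
    λ i 0<i i<len → uncurry (interior (φ i)) (φ-interior i 0<i i<len)
    where
    open IndexWindow s≤t
    cover′ : ∀ v → S v → ∃[ i ] q (φ i) ≡ v
    cover′ v Sv with cover v Sv
    ... | m , s≤m , m≤t , refl with φ-onto m s≤m m≤t
    ...   | i , φi≡m = i , cong q φi≡m

data Among {A : Set} (a : A) : A → A → A → Set where
  first  : ∀ {y z} → Among a a y z
  second : ∀ {x z} → Among a x a z
  third  : ∀ {x y} → Among a x y a

Among-trans : ∀ {A : Set} {a x y z p q r : A} →
              Among a x y z → Among x p q r → Among y p q r → Among z p q r → Among a p q r
Among-trans first  x∈ _  _  = x∈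
Among-trans second _  y∈ _  = y∈
Among-trans third  _  _  z∈ = z∈

Among-swap₁₂ : ∀ {A : Set} {a x y z : A} → Among a x y z → Among a y x z
Among-swap₁₂ first  = second
Among-swap₁₂ second = first
Among-swap₁₂ third  = third

Tri-swap₁₂ : ∀ {h} (H : Graph h) {x y z} → Tri H x y z → Tri H y x z
Tri-swap₁₂ H (xy , yz , xz) = Adj-sym H xy , xz , yz

Tri-swap₂₃ : ∀ {h} (H : Graph h) {x y z} → Tri H x y z → Tri H x z y
Tri-swap₂₃ H (xy , yz , xz) = xz , Adj-sym H yz , xy

pattern in-one-bag o valid u∈ v∈ = inj₁ (o , valid , u∈ , v∈)
pattern between-interfaces x y z xy xz u∈ v∈ = inj₂ (inj₁ (x , y , z , xy , xz , u∈ , v∈))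
pattern interface-to-vertex x y xy u∈ v∈ = inj₂ (inj₂ (inj₁ (x , y , xy , u∈ , v∈)))
pattern triangle-to-edge x y z t u∈ v∈xy v∈yx =
  inj₂ (inj₂ (inj₂ (x , y , z , t , u∈ , v∈xy , v∈yx)))

module Decomposition {n h} {G : Graph n} {H : Graph h} (D : ESD G H) where

  -- The partition axioms only mention the increasing representatives (ValidObj) of edges and
  -- triangles, so every edge or triangle is first moved to its representative.
  record CanonicalEdge (x y : Fin h) : Set where
    field
      a b   : Fin h
      valid : ValidObj H (edg a b)
      η≡    : ηE D x y ≡ ηE D a b
      ends  : (x ≡ a × y ≡ b) ⊎ (x ≡ b × y ≡ a)

  canonicalEdge : ∀ {x y} → Adj H x y → CanonicalEdge x y
  canonicalEdge {x} {y} xy with <-cmp x y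
  ... | tri< x<y _ _ = record { a = x ; b = y ; valid = x<y , xy ; η≡ = refl
                              ; ends = inj₁ (refl , refl) }
  ... | tri≈ _ x≡y _ = ⊥-elim (Adj⇒≢ H xy x≡y)
  ... | tri> _ _ y<x = record { a = y ; b = x ; valid = y<x , Adj-sym H xy ; η≡ = ηE-sym D x y xy
                              ; ends = inj₂ (refl , refl) }

  record CanonicalTriangle (x y z : Fin h) : Set where
    field
      a b c : Fin h
      valid : ValidObj H (tri a b c)
      η≡    : ηT D x y z ≡ ηT D a b c
      x∈    : Among x a b c
      y∈    : Among y a b c
      a∈    : Among a x y z
      b∈    : Among b x y z
      c∈    : Among c x y z

  CanonicalTriangle-swap₁₂ : ∀ {x y z} → Tri H x y z →
                             CanonicalTriangle y x z → CanonicalTriangle x y z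
  CanonicalTriangle-swap₁₂ t T = record
    { a = a ; b = b ; c = c ; valid = valid ; η≡ = trans (ηT-sym₁ D _ _ _ t) η≡
    ; x∈ = y∈ ; y∈ = x∈ ; a∈ = Among-swap₁₂ a∈ ; b∈ = Among-swap₁₂ b∈ ; c∈ = Among-swap₁₂ c∈ }
    where open CanonicalTriangle T

  canonicalTriangle< : ∀ {x y z} → x < y → Tri H x y z → CanonicalTriangle x y z
  canonicalTriangle< {x} {y} {z} x<y t with <-cmp y z
  ... | tri< y<z _ _ = record { a = x ; b = y ; c = z ; valid = x<y , y<z , t ; η≡ = refl
                              ; x∈ = first ; y∈ = second ; a∈ = first ; b∈ = second ; c∈ = third }
  ... | tri≈ _ y≡z _ = ⊥-elim (Adj⇒≢ H (proj₁ (proj₂ t)) y≡z)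
  ... | tri> _ _ z<y with <-cmp x z
  ...   | tri< x<z _ _ = record { a = x ; b = z ; c = y ; valid = x<z , z<y , Tri-swap₂₃ H t
                                ; η≡ = ηT-sym₂ D x y z t
                                ; x∈ = first ; y∈ = third ; a∈ = first ; b∈ = third ; c∈ = second }
  ...   | tri≈ _ x≡z _ = ⊥-elim (Adj⇒≢ H (proj₂ (proj₂ t)) x≡z)
  ...   | tri> _ _ z<x = record { a = z ; b = x ; c = y
                                ; valid = z<x , x<y , Tri-swap₁₂ H (Tri-swap₂₃ H t)
                                ; η≡ = trans (ηT-sym₂ D x y z t) (ηT-sym₁ D x z y (Tri-swap₂₃ H t))
                                ; x∈ = second ; y∈ = third ; a∈ = third ; b∈ = first ; c∈ = second }

  canonicalTriangle : ∀ {x y z} → Tri H x y z → CanonicalTriangle x y z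
  canonicalTriangle {x} {y} t with <-cmp x y
  ... | tri< x<y _ _ = canonicalTriangle< x<y t
  ... | tri≈ _ x≡y _ = ⊥-elim (Adj⇒≢ H (proj₁ t) x≡y)
  ... | tri> _ _ y<x = CanonicalTriangle-swap₁₂ t (canonicalTriangle< y<x (Tri-swap₁₂ H t))

  ηV-unique : ∀ {c c′ v} → v ∈ ηV D c → v ∈ ηV D c′ → c ≡ c′
  ηV-unique {c} {c′} {v} v∈c v∈c′ with disjoint D v (vtx c) (vtx c′) _ _ v∈c v∈c′
  ... | refl = refl

  ηE-unique : ∀ {x y x′ y′ v} → Adj H x y → Adj H x′ y′ →
              v ∈ ηE D x y → v ∈ ηE D x′ y′ → (x ≡ x′ × y ≡ y′) ⊎ (x ≡ y′ × y ≡ x′)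
  ηE-unique {v = v} xy x′y′ v∈ v∈′ with canonicalEdge xy | canonicalEdge x′y′
  ... | record { a = a ; b = b ; valid = valid ; η≡ = η≡ ; ends = ends }
      | record { a = a′ ; b = b′ ; valid = valid′ ; η≡ = η≡′ ; ends = ends′ }
      with disjoint D v (edg a b) (edg a′ b′) valid valid′ (subst (v ∈_) η≡ v∈) (subst (v ∈_) η≡′ v∈′)
  ... | refl with ends | ends′
  ...   | inj₁ (refl , refl) | inj₁ (refl , refl) = inj₁ (refl , refl)
  ...   | inj₁ (refl , refl) | inj₂ (refl , refl) = inj₂ (refl , refl)
  ...   | inj₂ (refl , refl) | inj₁ (refl , refl) = inj₂ (refl , refl)
  ...   | inj₂ (refl , refl) | inj₂ (refl , refl) = inj₁ (refl , refl)

  ηT-unique : ∀ {x y z x′ y′ z′ v} → Tri H x y z → Tri H x′ y′ z′ →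
              v ∈ ηT D x y z → v ∈ ηT D x′ y′ z′ → Among x x′ y′ z′ × Among y x′ y′ z′
  ηT-unique {v = v} t t′ v∈ v∈′ with canonicalTriangle t | canonicalTriangle t′
  ... | record { a = a ; b = b ; c = c ; valid = valid ; η≡ = η≡ ; x∈ = x∈ ; y∈ = y∈ }
      | record { a = a′ ; b = b′ ; c = c′ ; valid = valid′ ; η≡ = η≡′ ; a∈ = a∈ ; b∈ = b∈ ; c∈ = c∈ }
      with disjoint D v (tri a b c) (tri a′ b′ c′) valid valid′
                    (subst (v ∈_) η≡ v∈) (subst (v ∈_) η≡′ v∈′)
  ... | refl = Among-trans x∈ a∈ b∈ c∈ , Among-trans y∈ a∈ b∈ c∈

  ηV∩ηE-empty : ∀ {c x y v} → Adj H x y → v ∈ ηV D c → v ∉ ηE D x y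
  ηV∩ηE-empty {c} {v = v} xy v∈V v∈E with canonicalEdge xy
  ... | record { a = a ; b = b ; valid = valid ; η≡ = η≡ }
      with disjoint D v (vtx c) (edg a b) _ valid v∈V (subst (v ∈_) η≡ v∈E)
  ... | ()

  ηV∩ηT-empty : ∀ {c x y z v} → Tri H x y z → v ∈ ηV D c → v ∉ ηT D x y z
  ηV∩ηT-empty {c} {v = v} t v∈V v∈T with canonicalTriangle t
  ... | record { a = a ; b = b ; c = c′ ; valid = valid ; η≡ = η≡ }
      with disjoint D v (vtx c) (tri a b c′) _ valid v∈V (subst (v ∈_) η≡ v∈T)
  ... | ()

  ηE∩ηT-empty : ∀ {x y x′ y′ z′ v} → Adj H x y → Tri H x′ y′ z′ →
                v ∈ ηE D x y → v ∉ ηT D x′ y′ z′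
  ηE∩ηT-empty {v = v} xy t v∈E v∈T with canonicalEdge xy | canonicalTriangle t
  ... | record { a = a ; b = b ; valid = valid ; η≡ = η≡ }
      | record { a = a′ ; b = b′ ; c = c′ ; valid = valid′ ; η≡ = η≡′ }
      with disjoint D v (edg a b) (tri a′ b′ c′) valid valid′
                    (subst (v ∈_) η≡ v∈E) (subst (v ∈_) η≡′ v∈T)
  ... | ()

  same-bag : ∀ {o o′ u v} → ValidObj H o → ValidObj H o′ →
             u ∈ ηO D o → v ∈ ηO D o → u ∈ ηO D o′ → v ∈ ηO D o′
  same-bag {o} {o′} {u} valid valid′ u∈o v∈o u∈o′ with disjoint D u o o′ valid valid′ u∈o u∈o′
  ... | refl = v∈o

  ηV-same-bag : ∀ {o u v c} → ValidObj H o → u ∈ ηO D o → v ∈ ηO D o →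
                u ∈ ηV D c → v ∈ ηV D c
  ηV-same-bag valid u∈o v∈o = same-bag {o′ = vtx _} valid _ u∈o v∈o

  ηE-same-bag : ∀ {o u v x y} → ValidObj H o → u ∈ ηO D o → v ∈ ηO D o →
                Adj H x y → u ∈ ηE D x y → v ∈ ηE D x y
  ηE-same-bag {u = u} {v} valid u∈o v∈o xy u∈E with canonicalEdge xy
  ... | record { a = a ; b = b ; valid = valid′ ; η≡ = η≡ } =
    subst (v ∈_) (sym η≡) (same-bag {o′ = edg a b} valid valid′ u∈o v∈o (subst (u ∈_) η≡ u∈E))

  ηT-same-bag : ∀ {o u v x y z} → ValidObj H o → u ∈ ηO D o → v ∈ ηO D o →
                Tri H x y z → u ∈ ηT D x y z → v ∈ ηT D x y z
  ηT-same-bag {u = u} {v} valid u∈o v∈o t u∈T with canonicalTriangle t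
  ... | record { a = a ; b = b ; c = c ; valid = valid′ ; η≡ = η≡ } =
    subst (v ∈_) (sym η≡) (same-bag {o′ = tri a b c} valid valid′ u∈o v∈o (subst (u ∈_) η≡ u∈T))

  ∈ηE-sym : ∀ {x y v} → Adj H x y → v ∈ ηE D x y → v ∈ ηE D y x
  ∈ηE-sym {x} {y} {v} xy = subst (v ∈_) (ηE-sym D x y xy)

  Hub : Fin h → Fin n → Set
  Hub c v = ∃[ f ] (Adj H c f × v ∈ ηI D c f)

  HubExcept : Fin h → Fin h → Fin n → Set
  HubExcept c f v = ∃[ g ] (g ≢ f × Adj H c g × v ∈ ηI D c g)

  HubExcept⇒Hub : ∀ {c f v} → HubExcept c f v → Hub c v
  HubExcept⇒Hub (g , _ , cg , v∈) = g , cg , v∈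

  Zone : Fin h → Fin h → Fin n → Set
  Zone c f v = v ∈ ηE D c f ⊎ v ∈ ηV D c ⊎ v ∈ ηV D f ⊎ ∃[ g ] (Tri H c f g × v ∈ ηT D c f g)

  Zone? : ∀ c f → Decidable (Zone c f)
  Zone? c f v = v ∈? ηE D c f ⊎-dec v ∈? ηV D c ⊎-dec v ∈? ηV D f ⊎-dec
                any? (λ g → (Adj? c f ×-dec Adj? f g ×-dec Adj? c g) ×-dec v ∈? ηT D c f g)
    where
    Adj? : ∀ x y → Dec (Adj H x y)
    Adj? x y = adj H x y Bool.≟ Bool.true

  Zone-same-bag : ∀ {o u v c f} → Adj H c f → ValidObj H o → u ∈ ηO D o → v ∈ ηO D o →
                  Zone c f u → Zone c f v
  Zone-same-bag cf valid u∈o v∈o (inj₁ u∈E) = inj₁ (ηE-same-bag valid u∈o v∈o cf u∈E)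
  Zone-same-bag cf valid u∈o v∈o (inj₂ (inj₁ u∈V)) = inj₂ (inj₁ (ηV-same-bag valid u∈o v∈o u∈V))
  Zone-same-bag cf valid u∈o v∈o (inj₂ (inj₂ (inj₁ u∈V))) =
    inj₂ (inj₂ (inj₁ (ηV-same-bag valid u∈o v∈o u∈V)))
  Zone-same-bag cf valid u∈o v∈o (inj₂ (inj₂ (inj₂ (g , t , u∈T)))) =
    inj₂ (inj₂ (inj₂ (g , t , ηT-same-bag valid u∈o v∈o t u∈T)))

  Zone∩ηE : ∀ {c f x y u} → Adj H x y → Zone c f u → u ∈ ηE D x y → u ∈ ηE D c f
  Zone∩ηE xy (inj₁ u∈E) _ = u∈E
  Zone∩ηE xy (inj₂ (inj₁ u∈V)) u∈E = ⊥-elim (ηV∩ηE-empty xy u∈V u∈E)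
  Zone∩ηE xy (inj₂ (inj₂ (inj₁ u∈V))) u∈E = ⊥-elim (ηV∩ηE-empty xy u∈V u∈E)
  Zone∩ηE xy (inj₂ (inj₂ (inj₂ (g , t , u∈T)))) u∈E = ⊥-elim (ηE∩ηT-empty xy t u∈E u∈T)

  Zone∩ηV : ∀ {c f x u} → Adj H c f → Zone c f u → u ∈ ηV D x → x ≡ c ⊎ x ≡ f
  Zone∩ηV cf (inj₁ u∈E) u∈V = ⊥-elim (ηV∩ηE-empty cf u∈V u∈E)
  Zone∩ηV cf (inj₂ (inj₁ u∈c)) u∈V = inj₁ (ηV-unique u∈V u∈c)
  Zone∩ηV cf (inj₂ (inj₂ (inj₁ u∈f))) u∈V = inj₂ (ηV-unique u∈V u∈f)
  Zone∩ηV cf (inj₂ (inj₂ (inj₂ (g , t , u∈T)))) u∈V = ⊥-elim (ηV∩ηT-empty t u∈V u∈T)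

  Zone∩ηT : ∀ {c f x y z u} → Adj H c f → Tri H x y z → Zone c f u → u ∈ ηT D x y z →
            ∃[ g ] (Tri H c f g × u ∈ ηT D c f g)
  Zone∩ηT cf t (inj₁ u∈E) u∈T = ⊥-elim (ηE∩ηT-empty cf t u∈E u∈T)
  Zone∩ηT cf t (inj₂ (inj₁ u∈V)) u∈T = ⊥-elim (ηV∩ηT-empty t u∈V u∈T)
  Zone∩ηT cf t (inj₂ (inj₂ (inj₁ u∈V))) u∈T = ⊥-elim (ηV∩ηT-empty t u∈V u∈T)
  Zone∩ηT cf t (inj₂ (inj₂ (inj₂ u∈cfg))) _ = u∈cfg

  Zone∩ηI : ∀ {c f x y u} → Adj H c f → Adj H x y → Zone c f u → u ∈ ηI D x y → x ≡ c ⊎ x ≡ f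
  Zone∩ηI cf xy u∈Z u∈I with ηI⊆ηE D _ _ xy u∈I
  ... | u∈E with ηE-unique xy cf u∈E (Zone∩ηE xy u∈Z u∈E)
  ...   | inj₁ (x≡c , _) = inj₁ x≡c
  ...   | inj₂ (x≡f , _) = inj₂ x≡f

  interface-off-edge : ∀ {c f z v} → Adj H c f → Adj H c z → v ∈ ηI D c z → v ∉ ηE D c f →
                       HubExcept c f v
  interface-off-edge {f = f} {z} cf cz v∈ v∉E with z ≟ f
  ... | yes refl = ⊥-elim (v∉E (ηI⊆ηE D _ _ cf v∈))
  ... | no z≢f = z , z≢f , cz , v∈

  interface-leaving-Zone : ∀ {c f x z v} → Adj H c f → x ≡ c ⊎ x ≡ f → Adj H x z → v ∈ ηI D x z →
                           ¬ Zone c f v → HubExcept c f v ⊎ HubExcept f c v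
  interface-leaving-Zone cf (inj₁ refl) xz v∈ v∉Z =
    inj₁ (interface-off-edge cf xz v∈ (v∉Z ∘ inj₁))
  interface-leaving-Zone cf (inj₂ refl) xz v∈ v∉Z =
    inj₂ (interface-off-edge (Adj-sym H cf) xz v∈ (v∉Z ∘ inj₁ ∘ ∈ηE-sym (Adj-sym H cf)))

  triangle-leaving-Zone : ∀ {c f x y z u v} → Adj H c f → Tri H x y z → u ∈ ηT D x y z → Zone c f u →
                          v ∈ ηI D x y → v ∈ ηI D y x → ¬ Zone c f v →
                          HubExcept c f v ⊎ HubExcept f c v
  triangle-leaving-Zone cf t@(xy , _ , _) u∈T u∈Z v∈xy v∈yx v∉Z with Zone∩ηT cf t u∈Z u∈T
  ... | g , t′ , u∈T′ with ηT-unique t t′ u∈T u∈T′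
  ...   | first  , _      = interface-leaving-Zone cf (inj₁ refl) xy v∈xy v∉Z
  ...   | second , _      = interface-leaving-Zone cf (inj₂ refl) xy v∈xy v∉Z
  ...   | third  , first  = interface-leaving-Zone cf (inj₁ refl) (Adj-sym H xy) v∈yx v∉Z
  ...   | third  , second = interface-leaving-Zone cf (inj₂ refl) (Adj-sym H xy) v∈yx v∉Z
  ...   | third  , third  = ⊥-elim (Adj⇒≢ H xy refl)

  Zone-∋-triangle : ∀ {c f x y z u v} → Adj H c f → Tri H x y z → u ∈ ηE D x y → Zone c f u →
                    v ∈ ηT D x y z → Zone c f v
  Zone-∋-triangle cf t@(xy , _ , _) u∈E u∈Z v∈T with ηE-unique xy cf u∈E (Zone∩ηE xy u∈Z u∈E)
  ... | inj₁ (refl , refl) = inj₂ (inj₂ (inj₂ (_ , t , v∈T)))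
  ... | inj₂ (refl , refl) =
    inj₂ (inj₂ (inj₂ (_ , Tri-swap₁₂ H t , subst (_ ∈_) (ηT-sym₁ D _ _ _ t) v∈T)))

  leaving-Zone : ∀ {c f u v} → Adj H c f → Adj G u v → Zone c f u → ¬ Zone c f v →
                 HubExcept c f v ⊎ HubExcept f c v
  leaving-Zone {u = u} {v} cf uv u∈Z v∉Z with edges D u v uv
  ... | inj₁ (in-one-bag o valid u∈ v∈) = ⊥-elim (v∉Z (Zone-same-bag cf valid u∈ v∈ u∈Z))
  ... | inj₁ (between-interfaces x y z xy xz u∈ v∈) =
    interface-leaving-Zone cf (Zone∩ηI cf xy u∈Z u∈) xz v∈ v∉Z
  ... | inj₁ (interface-to-vertex x y xy u∈ v∈) with Zone∩ηI cf xy u∈Z u∈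
  ...   | inj₁ refl = ⊥-elim (v∉Z (inj₂ (inj₁ v∈)))
  ...   | inj₂ refl = ⊥-elim (v∉Z (inj₂ (inj₂ (inj₁ v∈))))
  leaving-Zone cf uv u∈Z v∉Z | inj₁ (triangle-to-edge x y z t u∈ v∈xy v∈yx) =
    triangle-leaving-Zone cf t u∈ u∈Z v∈xy v∈yx v∉Z
  leaving-Zone cf uv u∈Z v∉Z | inj₂ (in-one-bag o valid v∈ u∈) =
    ⊥-elim (v∉Z (Zone-same-bag cf valid u∈ v∈ u∈Z))
  leaving-Zone cf uv u∈Z v∉Z | inj₂ (between-interfaces x y z xy xz v∈ u∈) =
    interface-leaving-Zone cf (Zone∩ηI cf xz u∈Z u∈) xy v∈ v∉Z
  leaving-Zone cf uv u∈Z v∉Z | inj₂ (interface-to-vertex x y xy v∈ u∈) =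
    interface-leaving-Zone cf (Zone∩ηV cf u∈Z u∈) xy v∈ v∉Z
  leaving-Zone cf uv u∈Z v∉Z | inj₂ (triangle-to-edge x y z t v∈ u∈xy u∈yx) =
    ⊥-elim (v∉Z (Zone-∋-triangle cf t (ηI⊆ηE D x y (proj₁ t) u∈xy) u∈Z v∈))

  leaving-ηV : ∀ {c u v} → Adj G u v → u ∈ ηV D c → v ∉ ηV D c → Hub c v
  leaving-ηV {u = u} {v} uv u∈V v∉V with edges D u v uv
  ... | inj₁ (in-one-bag o valid u∈ v∈) = ⊥-elim (v∉V (ηV-same-bag valid u∈ v∈ u∈V))
  ... | inj₁ (between-interfaces x y z xy xz u∈ v∈) =
    ⊥-elim (ηV∩ηE-empty xy u∈V (ηI⊆ηE D x y xy u∈))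
  ... | inj₁ (interface-to-vertex x y xy u∈ v∈) = ⊥-elim (ηV∩ηE-empty xy u∈V (ηI⊆ηE D x y xy u∈))
  ... | inj₁ (triangle-to-edge x y z t u∈ v∈xy v∈yx) = ⊥-elim (ηV∩ηT-empty t u∈V u∈)
  ... | inj₂ (in-one-bag o valid v∈ u∈) = ⊥-elim (v∉V (ηV-same-bag valid u∈ v∈ u∈V))
  ... | inj₂ (between-interfaces x y z xy xz v∈ u∈) =
    ⊥-elim (ηV∩ηE-empty xz u∈V (ηI⊆ηE D x z xz u∈))
  ... | inj₂ (interface-to-vertex x y xy v∈ u∈) with ηV-unique u∈ u∈V
  ...   | refl = y , xy , v∈
  leaving-ηV uv u∈V v∉V | inj₂ (triangle-to-edge x y z t v∈ u∈xy u∈yx) =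
    ⊥-elim (ηV∩ηE-empty (proj₁ t) u∈V (ηI⊆ηE D x y (proj₁ t) u∈xy))

  data EdgeExit (a b : Fin h) (u v : Fin n) : Set where
    via-a         : u ∈ ηI D a b → HubExcept a b v → EdgeExit a b u v
    via-b         : u ∈ ηI D b a → HubExcept b a v → EdgeExit a b u v
    into-vertex   : v ∈ ηV D a ⊎ v ∈ ηV D b → EdgeExit a b u v
    into-triangle : u ∈ ηI D a b → u ∈ ηI D b a → ∃[ g ] (Tri H a b g × v ∈ ηT D a b g) →
                    EdgeExit a b u v

  interface-leaving-ηE : ∀ {a b x y z u v} → Adj H a b → (x ≡ a × y ≡ b) ⊎ (x ≡ b × y ≡ a) →
                         u ∈ ηI D x y → Adj H x z → v ∈ ηI D x z → v ∉ ηE D a b → EdgeExit a b u v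
  interface-leaving-ηE ab (inj₁ (refl , refl)) u∈ xz v∈ v∉E =
    via-a u∈ (interface-off-edge ab xz v∈ v∉E)
  interface-leaving-ηE ab (inj₂ (refl , refl)) u∈ xz v∈ v∉E =
    via-b u∈ (interface-off-edge (Adj-sym H ab) xz v∈ (v∉E ∘ ∈ηE-sym (Adj-sym H ab)))

  leaving-ηE : ∀ {a b u v} → Adj H a b → Adj G u v → u ∈ ηE D a b → v ∉ ηE D a b →
               EdgeExit a b u v
  leaving-ηE {u = u} {v} ab uv u∈E v∉E with edges D u v uv
  ... | inj₁ (in-one-bag o valid u∈ v∈) = ⊥-elim (v∉E (ηE-same-bag valid u∈ v∈ ab u∈E))
  ... | inj₁ (between-interfaces x y z xy xz u∈ v∈) =
    interface-leaving-ηE ab (ηE-unique xy ab (ηI⊆ηE D x y xy u∈) u∈E) u∈ xz v∈ v∉E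
  ... | inj₁ (interface-to-vertex x y xy u∈ v∈) with ηE-unique xy ab (ηI⊆ηE D x y xy u∈) u∈E
  ...   | inj₁ (refl , refl) = into-vertex (inj₁ v∈)
  ...   | inj₂ (refl , refl) = into-vertex (inj₂ v∈)
  leaving-ηE ab uv u∈E v∉E | inj₁ (triangle-to-edge x y z t u∈ v∈xy v∈yx) =
    ⊥-elim (ηE∩ηT-empty ab t u∈E u∈)
  leaving-ηE ab uv u∈E v∉E | inj₂ (in-one-bag o valid v∈ u∈) =
    ⊥-elim (v∉E (ηE-same-bag valid u∈ v∈ ab u∈E))
  leaving-ηE ab uv u∈E v∉E | inj₂ (between-interfaces x y z xy xz v∈ u∈) =
    interface-leaving-ηE ab (ηE-unique xz ab (ηI⊆ηE D x z xz u∈) u∈E) u∈ xy v∈ v∉E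
  leaving-ηE ab uv u∈E v∉E | inj₂ (interface-to-vertex x y xy v∈ u∈) =
    ⊥-elim (ηV∩ηE-empty ab u∈ u∈E)
  leaving-ηE ab uv u∈E v∉E | inj₂ (triangle-to-edge x y z t v∈ u∈xy u∈yx)
    with ηE-unique (proj₁ t) ab (ηI⊆ηE D x y (proj₁ t) u∈xy) u∈E
  ... | inj₁ (refl , refl) = into-triangle u∈xy u∈yx (z , t , v∈)
  ... | inj₂ (refl , refl) =
    into-triangle u∈yx u∈xy (z , Tri-swap₁₂ H t , subst (_ ∈_) (ηT-sym₁ D x y z t) v∈)

  Pendant : Fin h → Fin h → Set
  Pendant α β = ∀ z → Adj H α z → z ≡ β

  LeafInterface : Fin n → Fin h → Fin h → Set
  LeafInterface v α β = ηI D α β ≡ ⁅ v ⁆ × Pendant α β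

  leaf∈ηI : ∀ {v α β} → LeafInterface v α β → v ∈ ηI D α β
  leaf∈ηI {v} (η≡ , _) = subst (v ∈_) (sym η≡) (x∈⁅x⁆ v)

  ∈leaf⇒≡ : ∀ {v w α β} → LeafInterface v α β → w ∈ ηI D α β → w ≡ v
  ∈leaf⇒≡ {v} {w} (η≡ , _) w∈ = x∈⁅y⁆⇒x≡y v (subst (w ∈_) η≡ w∈)

  peripheral-in-edge : ∀ {v} → Peripheral D v → ∃₂ λ α β → Adj H α β × v ∈ ηE D α β
  peripheral-in-edge (α , β , αβ , pendant , η≡) =
    α , β , αβ , ηI⊆ηE D α β αβ (leaf∈ηI (η≡ , pendant))

  peripheral-leaf : ∀ {v a b} → Peripheral D v → Adj H a b → v ∈ ηE D a b →
                    LeafInterface v a b ⊎ LeafInterface v b a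
  peripheral-leaf (α , β , αβ , pendant , η≡) ab v∈
    with ηE-unique αβ ab (ηI⊆ηE D α β αβ (leaf∈ηI (η≡ , pendant))) v∈
  ... | inj₁ (refl , refl) = inj₁ (η≡ , pendant)
  ... | inj₂ (refl , refl) = inj₂ (η≡ , pendant)

  peripheral∉ηV : ∀ {v c} → Peripheral D v → v ∉ ηV D c
  peripheral∉ηV P v∈V with peripheral-in-edge P
  ... | _ , _ , αβ , v∈E = ηV∩ηE-empty αβ v∈V v∈E

  peripheral-Zone : ∀ {v c f} → Peripheral D v → Zone c f v → v ∈ ηE D c f
  peripheral-Zone P v∈Z with peripheral-in-edge P
  ... | _ , _ , αβ , v∈E = Zone∩ηE αβ v∈Z v∈E

module OnPath {n h} {G : Graph n} {H : Graph h} (D : ESD G H)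
  {x y : Fin n} (x≢y : x ≢ y) (Px : Peripheral D x) (Py : Peripheral D y)
  {k : ℕ} {q : Fin (suc k) → Fin n} (q-induced : IsInducedPath G q)
  (q0 : q zero ≡ x) (qk : q (fromℕ k) ≡ y) where

  open Decomposition D

  q-step : ∀ {l r} → Step l r → Adj G (q l) (q r)
  q-step {l} {r} l→r = proj₂ (proj₂ q-induced l r) (inj₂ l→r)

  q-step⁻ : ∀ {l r} → Step l r → Adj G (q r) (q l)
  q-step⁻ {l} {r} l→r = proj₂ (proj₂ q-induced r l) (inj₁ l→r)

  ≪⇒¬Adj : ∀ {i j} → i ≪ j → ¬ Adj G (q i) (q j)
  ≪⇒¬Adj {i} {j} i≪j ij with proj₁ (proj₂ q-induced i j) ij
  ... | inj₁ i≡1+j = ℕ.<-asym (≪⇒< i≪j) (ℕ.≤-reflexive (sym i≡1+j))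
  ... | inj₂ j≡1+i = ℕ.<-irrefl (sym j≡1+i) i≪j

  q≡x⇒zero : ∀ {i} → q i ≡ x → i ≡ zero
  q≡x⇒zero qi≡x = proj₁ q-induced (trans qi≡x (sym q0))

  q≡y⇒last : ∀ {i} → q i ≡ y → i ≡ fromℕ k
  q≡y⇒last qi≡y = proj₁ q-induced (trans qi≡y (sym qk))

  -- The end α of the strip αβ is sealed off to the left (right) of index i.
  BlockedLeft : Fin h → Fin h → Fin (suc k) → Set
  BlockedLeft α β i = LeafInterface x α β ⊎ ∃[ l ] (l < i × HubExcept α β (q l))

  BlockedRight : Fin h → Fin h → Fin (suc k) → Set
  BlockedRight α β i = LeafInterface y α β ⊎ ∃[ r ] (i < r × HubExcept α β (q r))

  BlockedLeft-mono : ∀ {α β i i′} → i ≤ i′ → BlockedLeft α β i → BlockedLeft α β i′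
  BlockedLeft-mono i≤i′ (inj₁ leaf) = inj₁ leaf
  BlockedLeft-mono i≤i′ (inj₂ (l , l<i , hl)) = inj₂ (l , ℕ.≤-trans l<i i≤i′ , hl)

  BlockedRight-mono : ∀ {α β i i′} → i′ ≤ i → BlockedRight α β i → BlockedRight α β i′
  BlockedRight-mono i′≤i (inj₁ leaf) = inj₁ leaf
  BlockedRight-mono i′≤i (inj₂ (r , i<r , hr)) = inj₂ (r , ℕ.≤-<-trans i′≤i i<r , hr)

  BlockedLeft⇒∉ηI : ∀ {α β i j} → Adj H α β → BlockedLeft α β i → i < j → q j ∉ ηI D α β
  BlockedLeft⇒∉ηI αβ (inj₁ leaf) i<j qj∈ with q≡x⇒zero (∈leaf⇒≡ leaf qj∈)
  ... | refl = ℕ.n≮0 i<j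
  BlockedLeft⇒∉ηI {α} {β} {j = j} αβ (inj₂ (l , l<i , g , g≢β , αg , ql∈)) i<j qj∈ =
    ≪⇒¬Adj (ℕ.≤-trans (s≤s l<i) i<j) (complete D α g β αg αβ g≢β (q l) (q j) ql∈ qj∈)

  BlockedRight⇒∉ηI : ∀ {α β i j} → Adj H α β → BlockedRight α β j → i < j → q i ∉ ηI D α β
  BlockedRight⇒∉ηI {j = j} αβ (inj₁ leaf) i<j qi∈ with q≡y⇒last (∈leaf⇒≡ leaf qi∈)
  ... | refl = ℕ.<-irrefl (toℕ-fromℕ k) (ℕ.<-≤-trans i<j (ℕ.≤-pred (toℕ<n j)))
  BlockedRight⇒∉ηI {α} {β} {i} αβ (inj₂ (r , j<r , g , g≢β , αg , qr∈)) i<j qi∈ =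
    ≪⇒¬Adj (ℕ.≤-trans (s≤s i<j) j<r) (complete D α β g αβ αg (g≢β ∘ sym) (q i) (q r) qi∈ qr∈)

  blocked-both-sides : ∀ {α β i j} → BlockedLeft α β i → BlockedRight α β j →
                       ∃₂ λ l r → l < i × j < r × Hub α (q l) × Hub α (q r)
  blocked-both-sides (inj₁ leaf-x) (inj₁ leaf-y) = ⊥-elim (x≢y (∈leaf⇒≡ leaf-y (leaf∈ηI leaf-x)))
  blocked-both-sides (inj₁ (_ , pendant)) (inj₂ (_ , _ , g , g≢β , αg , _)) =
    ⊥-elim (g≢β (pendant g αg))
  blocked-both-sides (inj₂ (_ , _ , g , g≢β , αg , _)) (inj₁ (_ , pendant)) =
    ⊥-elim (g≢β (pendant g αg))
  blocked-both-sides (inj₂ (l , l<i , hl)) (inj₂ (r , j<r , hr)) =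
    l , r , l<i , j<r , HubExcept⇒Hub hl , HubExcept⇒Hub hr

  zone-left : ∀ {c f i} → Adj H c f → Zone c f (q i) → BlockedLeft c f i ⊎ BlockedLeft f c i
  zone-left {c} {f} {i} cf qi∈Z with lowest (Zone? c f ∘ q) qi∈Z
  ... | s , s≤i , qs∈Z , inj₁ refl , _ =
    Sum.map inj₁ inj₁ (peripheral-leaf Px cf (peripheral-Zone Px (subst (Zone c f) q0 qs∈Z)))
  ... | s , s≤i , qs∈Z , inj₂ (l , l→s , ql∉Z) , _ =
    Sum.map blocked blocked (leaving-Zone cf (q-step⁻ l→s) qs∈Z ql∉Z)
    where
    blocked : ∀ {α β} → HubExcept α β (q l) → BlockedLeft α β i
    blocked hl = inj₂ (l , ℕ.<-≤-trans (Step⇒< l→s) s≤i , hl)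

  zone-right : ∀ {c f j} → Adj H c f → Zone c f (q j) → BlockedRight c f j ⊎ BlockedRight f c j
  zone-right {c} {f} {j} cf qj∈Z with highest (Zone? c f ∘ q) qj∈Z
  ... | t , j≤t , qt∈Z , inj₁ refl , _ =
    Sum.map inj₁ inj₁ (peripheral-leaf Py cf (peripheral-Zone Py (subst (Zone c f) qk qt∈Z)))
  ... | t , j≤t , qt∈Z , inj₂ (r , t→r , qr∉Z) , _ =
    Sum.map blocked blocked (leaving-Zone cf (q-step t→r) qt∈Z qr∉Z)
    where
    blocked : ∀ {α β} → HubExcept α β (q r) → BlockedRight α β j
    blocked hr = inj₂ (r , ℕ.≤-<-trans j≤t (Step⇒< t→r) , hr)

  hub-descent : ∀ {c i j} → Hub c (q i) → Hub c (q j) → i ≪ j →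
                ∃[ f ] ∃₂ λ l r → l < i × j < r × Hub f (q l) × Hub f (q r)
  hub-descent {c} {i} {j} (f , cf , qi∈) (f′ , cf′ , qj∈) i≪j with f ≟ f′
  ... | no f≢f′ = ⊥-elim (≪⇒¬Adj i≪j (complete D c f f′ cf cf′ f≢f′ (q i) (q j) qi∈ qj∈))
  ... | yes refl with zone-left cf (inj₁ (ηI⊆ηE D c f cf qi∈))
                    | zone-right cf (inj₁ (ηI⊆ηE D c f cf qj∈))
  ...   | inj₁ blocked | _ = ⊥-elim (BlockedLeft⇒∉ηI cf blocked (≪⇒< i≪j) qj∈)
  ...   | inj₂ _ | inj₁ blocked = ⊥-elim (BlockedRight⇒∉ηI cf blocked (≪⇒< i≪j) qi∈)
  ...   | inj₂ blocked-left | inj₂ blocked-right = f , blocked-both-sides blocked-left blocked-right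

  hub-close : ∀ {c i j} → Hub c (q i) → Hub c (q j) → ¬ i ≪ j
  hub-close {i = i} = go (<-wellFounded i)
    where
    go : ∀ {c i j} → Acc _<_ i → Hub c (q i) → Hub c (q j) → ¬ i ≪ j
    go (acc smaller) qi∈ qj∈ i≪j with hub-descent qi∈ qj∈ i≪j
    ... | f , l , r , l<i , j<r , ql∈ , qr∈ =
      go (smaller l<i) ql∈ qr∈ (≪-widen l<i (ℕ.<⇒≤ (≪⇒< i≪j)) j<r)

  path-avoids-ηV : ∀ {c i} → q i ∉ ηV D c
  path-avoids-ηV {c} qi∈ with lowest (λ j → q j ∈? ηV D c) qi∈ | highest (λ j → q j ∈? ηV D c) qi∈
  ... | _ , _ , qs∈ , inj₁ refl , _ | _ = peripheral∉ηV Px (subst (_∈ ηV D c) q0 qs∈)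
  ... | _ | _ , _ , qt∈ , inj₁ refl , _ = peripheral∉ηV Py (subst (_∈ ηV D c) qk qt∈)
  ... | s , s≤i , qs∈ , inj₂ (l , l→s , ql∉) , _ | t , i≤t , qt∈ , inj₂ (r , t→r , qr∉) , _ =
    hub-close (leaving-ηV (q-step⁻ l→s) qs∈ ql∉) (leaving-ηV (q-step t→r) qt∈ qr∉)
              (≪-widen (Step⇒< l→s) (ℕ.≤-trans s≤i i≤t) (Step⇒< t→r))

  module OnEdge {a b : Fin h} (ab : Adj H a b) where

    E : Subset n
    E = ηE D a b

    E? : Decidable (λ i → q i ∈ E)
    E? i = q i ∈? E

    Section : Fin n → Set
    Section v = v ∈ E × ∃[ j ] (q j ≡ v)

    LeftEnd : Fin h → Fin h → Fin (suc k) → Set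
    LeftEnd α β s = q s ∈ ηI D α β × BlockedLeft α β s

    RightEnd : Fin h → Fin h → Fin (suc k) → Set
    RightEnd α β t = q t ∈ ηI D α β × BlockedRight α β t

    left-end : ∀ {s} → q s ∈ E → StartsAt (λ i → q i ∈ E) s → LeftEnd a b s ⊎ LeftEnd b a s
    left-end qs∈E (inj₁ refl) with peripheral-leaf Px ab (subst (_∈ E) q0 qs∈E)
    ... | inj₁ leaf = inj₁ (subst (_∈ ηI D a b) (sym q0) (leaf∈ηI leaf) , inj₁ leaf)
    ... | inj₂ leaf = inj₂ (subst (_∈ ηI D b a) (sym q0) (leaf∈ηI leaf) , inj₁ leaf)
    left-end qs∈E (inj₂ (l , l→s , ql∉E)) with leaving-ηE ab (q-step⁻ l→s) qs∈E ql∉E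
    ... | via-a qs∈ hl = inj₁ (qs∈ , inj₂ (l , Step⇒< l→s , hl))
    ... | via-b qs∈ hl = inj₂ (qs∈ , inj₂ (l , Step⇒< l→s , hl))
    ... | into-vertex (inj₁ ql∈) = ⊥-elim (path-avoids-ηV ql∈)
    ... | into-vertex (inj₂ ql∈) = ⊥-elim (path-avoids-ηV ql∈)
    ... | into-triangle qs∈ab qs∈ba ql∈T with zone-left ab (inj₂ (inj₂ (inj₂ ql∈T)))
    ...   | inj₁ blocked = inj₁ (qs∈ab , BlockedLeft-mono (ℕ.<⇒≤ (Step⇒< l→s)) blocked)
    ...   | inj₂ blocked = inj₂ (qs∈ba , BlockedLeft-mono (ℕ.<⇒≤ (Step⇒< l→s)) blocked)

    right-end : ∀ {t} → q t ∈ E → EndsAt (λ i → q i ∈ E) t → RightEnd a b t ⊎ RightEnd b a t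
    right-end qt∈E (inj₁ refl) with peripheral-leaf Py ab (subst (_∈ E) qk qt∈E)
    ... | inj₁ leaf = inj₁ (subst (_∈ ηI D a b) (sym qk) (leaf∈ηI leaf) , inj₁ leaf)
    ... | inj₂ leaf = inj₂ (subst (_∈ ηI D b a) (sym qk) (leaf∈ηI leaf) , inj₁ leaf)
    right-end qt∈E (inj₂ (r , t→r , qr∉E)) with leaving-ηE ab (q-step t→r) qt∈E qr∉E
    ... | via-a qt∈ hr = inj₁ (qt∈ , inj₂ (r , Step⇒< t→r , hr))
    ... | via-b qt∈ hr = inj₂ (qt∈ , inj₂ (r , Step⇒< t→r , hr))
    ... | into-vertex (inj₁ qr∈) = ⊥-elim (path-avoids-ηV qr∈)
    ... | into-vertex (inj₂ qr∈) = ⊥-elim (path-avoids-ηV qr∈)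
    ... | into-triangle qt∈ab qt∈ba qr∈T with zone-right ab (inj₂ (inj₂ (inj₂ qr∈T)))
    ...   | inj₁ blocked = inj₁ (qt∈ab , BlockedRight-mono (ℕ.<⇒≤ (Step⇒< t→r)) blocked)
    ...   | inj₂ blocked = inj₂ (qt∈ba , BlockedRight-mono (ℕ.<⇒≤ (Step⇒< t→r)) blocked)

    ends-clash : ∀ {α β s t} → LeftEnd α β s → RightEnd α β t → ¬ s ≤ t
    ends-clash (_ , blocked-left) (_ , blocked-right) s≤t
      with blocked-both-sides blocked-left blocked-right
    ... | l , r , l<s , t<r , ql∈ , qr∈ = hub-close ql∈ qr∈ (≪-widen l<s s≤t t<r)

    no-end-inside : ∀ {α β s t m} → Adj H α β → LeftEnd α β s → RightEnd β α t →
                    s ≤ m → m < t → ¬ (RightEnd α β m ⊎ RightEnd β α m)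
    no-end-inside αβ left _ s≤m _ (inj₁ right) = ends-clash left right s≤m
    no-end-inside αβ _ (_ , blocked) _ m<t (inj₂ (qm∈ , _)) =
      BlockedRight⇒∉ηI (Adj-sym H αβ) blocked m<t qm∈

    contiguous : ∀ {s t : Fin (suc k)} →
                 (∀ {m} → s ≤ m → m < t → ¬ (RightEnd a b m ⊎ RightEnd b a m)) →
                 q s ∈ E → ∀ m → s ≤ m → m ≤ t → q m ∈ E
    contiguous no-end qs∈E m s≤m m≤t with E? m
    ... | yes qm∈E = qm∈E
    ... | no qm∉E with crossing E? qs∈E qm∉E s≤m
    ...   | l , r , l→r , s≤l , r≤m , ql∈E , qr∉E =
      ⊥-elim (no-end s≤l (ℕ.<-≤-trans (Step⇒< l→r) (ℕ.≤-trans r≤m m≤t))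
                     (right-end ql∈E (inj₂ (r , l→r , qr∉E))))

    strip-path : ∀ {α β s t} → Adj H α β → LeftEnd α β s → RightEnd β α t → s ≤ t →
                 (∀ m → s ≤ m → m ≤ t → q m ∈ E) → (∀ j → q j ∈ E → s ≤ j × j ≤ t) →
                 InducedPathOn G Section (ηI D α β) (ηI D β α)
    strip-path {α} {β} {s} {t} αβ (qs∈ , blocked-left) (qt∈ , blocked-right) s≤t inside bounds =
      segment {G = G} q-induced Section (ηI D α β) (ηI D β α) s≤t
        (λ m s≤m m≤t → inside m s≤m m≤t , m , refl) cover qs∈ qt∈ interior
      where
      cover : ∀ v → Section v → ∃[ m ] (s ≤ m × m ≤ t × q m ≡ v)
      cover v (v∈E , m , refl) = m , proj₁ (bounds m v∈E) , proj₂ (bounds m v∈E) , refl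
      interior : ∀ m → s < m → m < t → q m ∉ ηI D α β × q m ∉ ηI D β α
      interior m s<m m<t =
        BlockedLeft⇒∉ηI αβ blocked-left s<m , BlockedRight⇒∉ηI (Adj-sym H αβ) blocked-right m<t

    section-path : ∀ {s t : Fin (suc k)} → s ≤ t → q s ∈ E → (∀ j → q j ∈ E → s ≤ j × j ≤ t) →
                   LeftEnd a b s ⊎ LeftEnd b a s → RightEnd a b t ⊎ RightEnd b a t →
                   InducedPathOn G Section (ηI D a b) (ηI D b a)
    section-path s≤t _ _ (inj₁ left) (inj₁ right) = ⊥-elim (ends-clash left right s≤t)
    section-path s≤t _ _ (inj₂ left) (inj₂ right) = ⊥-elim (ends-clash left right s≤t)
    section-path s≤t qs∈E bounds (inj₁ left) (inj₂ right) =
      strip-path ab left right s≤t (contiguous (no-end-inside ab left right) qs∈E) bounds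
    section-path {s} {t} s≤t qs∈E bounds (inj₂ left) (inj₁ right) =
      InducedPathOn-swap {G = G} (strip-path ba left right s≤t (contiguous no-end qs∈E) bounds)
      where
      ba : Adj H b a
      ba = Adj-sym H ab
      no-end : ∀ {m} → s ≤ m → m < t → ¬ (RightEnd a b m ⊎ RightEnd b a m)
      no-end s≤m m<t = no-end-inside ba left right s≤m m<t ∘ Sum.swap

corollary11 : ∀ {n h} (G : Graph n) (H : Graph h) (D : ESD G H)
    (x y : Fin n) → x ≢ y → Peripheral D x → Peripheral D y →
    (k : ℕ) (q : Fin (suc k) → Fin n) → IsInducedPath G q →
    q zero ≡ x → q (fromℕ k) ≡ y →
    ∀ a b → Adj H a b →
    (∃[ j ] (q j ∈ ηE D a b)) →
    InducedPathOn G (λ v → v ∈ ηE D a b × ∃[ j ] (q j ≡ v)) (ηI D a b) (ηI D b a)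
corollary11 G H D x y x≢y Px Py k q q-induced q0 qk a b ab (j , qj∈E) =
  let open OnPath D x≢y Px Py q-induced q0 qk
      open OnEdge ab
      (s , s≤j , qs∈E , start , below) = lowest E? qj∈E
      (t , j≤t , qt∈E , end , above) = highest E? qj∈E
  in section-path (ℕ.≤-trans s≤j j≤t) qs∈E (within-extremes below above)
                  (left-end qs∈E start) (right-end qt∈E end)
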